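{- Let $G$ be a binary simple stochastic game and let $\sigma,\sigma'$ be two MAX strategies with $S_\sigma=S_{\sigma'}$. Then $v_\sigma=v_{\sigma'}$ and $\sigma(x)=\sigma'(x)$ for every $x\in S_\sigma$.
   Context: A simple stochastic game (SSG) is a directed graph $G=(V,E)$ whose vertex set is partitioned into $V_{\text{MAX}}$, $V_{\text{MIN}}$, $V_R$ (random) and $V_S$ (sinks), such that every MAX and MIN vertex has outdegree at least $2$, every random vertex $x$ has outdegree at least $1$ and a rational probability distribution $p_x$ on its out-neighbours, and every sink $x$ has a rational value $\mathrm{Val}(x)\in[0,1]$. It is binary if every MAX vertex has outdegree exactly $2$. A token starts at a vertex; at a MAX (resp. MIN) vertex the corresponding player moves it along an outgoing arc, at a random vertex $x$ it moves according to $p_x$, and the game ends when a sink is reached. A (positional) MAX strategy is a map $\sigma:V_{\text{MAX}}\to V$ with $(x,\sigma(x))\in E$; MIN strategies are defined analogously. For a pair $(\sigma,\tau)$ and $x_0\in V$, $v_{\sigma,\tau}(x_0)=\sum_{s\in V_S}\mathbb{P}_{\sigma,\tau}(x_0\to s)\mathrm{Val}(s)$, the expected sink value of the play from $x_0$ (plays never reaching a sink contribute $0$). Value vectors are compared pointwise. For every MAX strategy $\sigma$ there is a MIN best response $\tau(\sigma)$ with $v_{\sigma,\tau(\sigma)}(x)\le v_{\sigma,\tau}(x)$ for all MIN strategies $\tau$ and all $x$; write $v_\sigma=v_{\sigma,\tau(\sigma)}$. The switch set $S_\sigma$ is the set of MAX vertices $x$ having an out-neighbour $y$ with $v_\sigma(y)>v_\sigma(x)$.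 -}

module Defs where

open import Data.Nat using (ℕ; zero; suc)
open import Data.Fin using (Fin; zero; suc)
open import Data.Bool using (Bool; T)
open import Data.Rational using (ℚ; 0ℚ; 1ℚ; _+_; _*_; _≤_; _<_)
open import Data.Product using (Σ; ∃; ∃-syntax; _×_; _,_; proj₁)
open import Data.Sum using (_⊎_)
open import Relation.Binary.PropositionalEquality using (_≡_)
open import Relation.Nullary using (¬_)

data Kind : Set where
  MAXv MINv RANDv SINKv : Kind

sumℚ : ∀ {n} → (Fin n → ℚ) → ℚ
sumℚ {zero}  f = 0ℚ
sumℚ {suc n} f = f zero + sumℚ (λ i → f (suc i))

record Game (n : ℕ) : Set where
  field
    kind : Fin n → Kind
    edge : Fin n → Fin n → Bool        -- (x , y) ∈ E  iff  T (edge x y)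
    prob : Fin n → Fin n → ℚ           -- p_x(y) for random vertices x
    val  : Fin n → ℚ                   -- Val(x) for sinks x
open Game public

Arc : ∀ {n} → Game n → Fin n → Fin n → Set
Arc g x y = T (edge g x y)

record IsSSG {n : ℕ} (g : Game n) : Set where
  field
    maxDeg  : ∀ x → kind g x ≡ MAXv →
              ∃[ y ] ∃[ y′ ] (¬ y ≡ y′ × Arc g x y × Arc g x y′)
    minDeg  : ∀ x → kind g x ≡ MINv →
              ∃[ y ] ∃[ y′ ] (¬ y ≡ y′ × Arc g x y × Arc g x y′)
    randDeg : ∀ x → kind g x ≡ RANDv → ∃[ y ] Arc g x y
    probNonneg  : ∀ x y → kind g x ≡ RANDv → 0ℚ ≤ prob g x y
    probSupport : ∀ x y → kind g x ≡ RANDv → ¬ prob g x y ≡ 0ℚ → Arc g x y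
    probSum     : ∀ x → kind g x ≡ RANDv → sumℚ (prob g x) ≡ 1ℚ
    valLow  : ∀ x → kind g x ≡ SINKv → 0ℚ ≤ val g x
    valHigh : ∀ x → kind g x ≡ SINKv → val g x ≤ 1ℚ

IsBinary : ∀ {n} → Game n → Set
IsBinary {n} g = ∀ x → kind g x ≡ MAXv →
  ∃[ y ] ∃[ y′ ] (¬ y ≡ y′ × Arc g x y × Arc g x y′ ×
                  (∀ z → Arc g x z → z ≡ y ⊎ z ≡ y′))

-- Positional strategies (values at vertices of the other kinds are irrelevant).
MaxStrategy : ∀ {n} → Game n → Set
MaxStrategy {n} g = Σ (Fin n → Fin n) λ σ → ∀ x → kind g x ≡ MAXv → Arc g x (σ x)

MinStrategy : ∀ {n} → Game n → Set
MinStrategy {n} g = Σ (Fin n → Fin n) λ τ → ∀ x → kind g x ≡ MINv → Arc g x (τ x)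

-- Expected sink value of plays that reach a sink within k steps
-- (plays not yet absorbed contribute 0).
horizon : ∀ {n} (g : Game n) → MaxStrategy g → MinStrategy g → ℕ → Fin n → ℚ
horizon g σ τ k x = go k x (kind g x)
  where
  go : ℕ → (x : _) → Kind → ℚ
  go k       x SINKv = val g x
  go zero    x _     = 0ℚ
  go (suc k) x MAXv  = horizon g σ τ k (proj₁ σ x)
  go (suc k) x MINv  = horizon g σ τ k (proj₁ τ x)
  go (suc k) x RANDv = sumℚ (λ y → prob g x y * horizon g σ τ k y)

-- v is v_{σ,τ}: the expected sink value, i.e. the supremum over k of the
-- k-step absorbed values (monotone convergence), which lies in ℚ.
IsValue : ∀ {n} (g : Game n) → MaxStrategy g → MinStrategy g → (Fin n → ℚ) → Set
IsValue {n} g σ τ v =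
  (∀ k x → horizon g σ τ k x ≤ v x) ×
  (∀ (u : Fin n → ℚ) → (∀ k x → horizon g σ τ k x ≤ u x) → ∀ x → v x ≤ u x)

-- v is v_σ = v_{σ,τ(σ)} for a MIN best response τ(σ).
IsMaxValue : ∀ {n} (g : Game n) → MaxStrategy g → (Fin n → ℚ) → Set
IsMaxValue {n} g σ v = Σ (MinStrategy g) λ τ →
  IsValue g σ τ v ×
  (∀ (τ′ : MinStrategy g) (u : Fin n → ℚ) → IsValue g σ τ′ u → ∀ x → v x ≤ u x)

-- x ∈ S_σ where v = v_σ.
InSwitch : ∀ {n} (g : Game n) → (Fin n → ℚ) → Fin n → Set
InSwitch g v x = kind g x ≡ MAXv × ∃[ y ] (Arc g x y × v x < v y)

-- Let τ be MIN's best response to σ and gap = v_σ′ − v_σ. If S_σ ⊆ S_σ′ and the maximum M of gap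
-- were positive, the vertices where gap = M would form a trap for (σ′, τ): sinks have gap 0,
-- random vertices average gap, MIN vertices keep v_σ and cannot lower v_σ′ (best responses are
-- locally optimal), and at a MAX vertex z either v_σ (σ′ z) ≤ v_σ (σ z), so gap stays M, or z is
-- a σ-switch, hence a σ′-switch, and by binarity its improving arc for v_σ′ is σ z, where gap > M.
-- Plays of (σ′, τ) from a trap never stop, so v_σ′ ≤ v_{σ′,τ} = 0 there, contradicting M > 0.
-- Hence v_σ′ ≤ v_σ, by symmetry v_σ = v_σ′, and then binarity forces σ = σ′ on the switch set.
-- Values are least fixed points of the affine maps x ↦ c + P x of plays; that these exist in ℚ
-- (needed for v_{σ′,τ} and for MIN's deviations) follows by eliminating one vertex at a time.

{-# OPTIONS --safe #-}
module Submission where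

open import Defs
open import Data.Nat as ℕ using (ℕ; zero; suc)
import Data.Nat.Properties as ℕₚ
import Data.Integer as ℤ
import Data.Integer.Properties as ℤₚ
open import Data.Rational
open import Data.Rational.Properties
open import Data.Rational.Solver using (module +-*-Solver)
import Data.Rational.Unnormalised as ℚᵘ
import Data.Rational.Unnormalised.Properties as ℚᵘ
open import Data.Fin as Fin using (Fin; zero; suc)
open import Data.Vec.Functional using (Vector; _∷_; tail; updateAt)
open import Data.Vec.Functional.Properties using (updateAt-updates; updateAt-minimal)
open import Data.List using (allFin)
import Data.List.Relation.Unary.All as All
open import Data.List.Membership.Propositional.Properties using (∈-allFin)
open import Relation.Binary using (DecTotalOrder)
open import Data.List.Extrema (DecTotalOrder.totalOrder ≤-decTotalOrder) using (argmax; f[xs]≤f[argmax])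
open import Data.Product using (Σ; ∃; _×_; _,_; proj₁; proj₂)
open import Data.Sum using (inj₁; inj₂)
open import Data.Empty using (⊥-elim)
open import Relation.Nullary using (¬_; Dec; yes; no)
open import Relation.Binary.PropositionalEquality

open +-*-Solver using (solve; _:=_; _:+_; _:*_; _:-_; con)

0≤1 : 0ℚ ≤ 1ℚ
0≤1 = <⇒≤ (positive⁻¹ 1ℚ)

+-nonNeg : ∀ {p q} → 0ℚ ≤ p → 0ℚ ≤ q → 0ℚ ≤ p + q
+-nonNeg = +-mono-≤

*-nonNeg : ∀ {p q} → 0ℚ ≤ p → 0ℚ ≤ q → 0ℚ ≤ p * q
*-nonNeg {p} {q} 0≤p 0≤q =
  nonNegative⁻¹ _ {{nonNeg*nonNeg⇒nonNeg p {{nonNegative 0≤p}} q {{nonNegative 0≤q}}}}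

*-monoˡ-≤-0≤ : ∀ {p q} r → 0ℚ ≤ r → p ≤ q → r * p ≤ r * q
*-monoˡ-≤-0≤ r 0≤r = *-monoˡ-≤-nonNeg r {{nonNegative 0≤r}}

p+[q-p]≡q : ∀ p q → p + (q - p) ≡ q
p+[q-p]≡q = solve 2 (λ p q → p :+ (q :- p) := q) refl

p≤q⇒0≤q-p : ∀ {p q} → p ≤ q → 0ℚ ≤ q - p
p≤q⇒0≤q-p {p} {q} p≤q = subst (_≤ q - p) (+-inverseʳ p) (+-monoˡ-≤ (- p) p≤q)

0≤q-p⇒p≤q : ∀ {p q} → 0ℚ ≤ q - p → p ≤ q
0≤q-p⇒p≤q {p} {q} h = subst₂ _≤_ (+-identityʳ p) (p+[q-p]≡q p q) (+-monoʳ-≤ p h)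

p<q⇒0<q-p : ∀ {p q} → p < q → 0ℚ < q - p
p<q⇒0<q-p {p} {q} p<q = subst (_< q - p) (+-inverseʳ p) (+-monoˡ-< (- p) p<q)

0<q-p⇒p<q : ∀ {p q} → 0ℚ < q - p → p < q
0<q-p⇒p<q {p} {q} h = subst₂ _<_ (+-identityʳ p) (p+[q-p]≡q p q) (+-monoʳ-< p h)

≤-via-difference : ∀ {p q} r → q - p ≡ r → 0ℚ ≤ r → p ≤ q
≤-via-difference r q-p≡r 0≤r = 0≤q-p⇒p≤q (subst (0ℚ ≤_) (sym q-p≡r) 0≤r)

p+q≤r⇒q≤r-p : ∀ {p q r} → p + q ≤ r → q ≤ r - p
p+q≤r⇒q≤r-p {p} {q} {r} h = ≤-via-difference (r - (p + q))
  (solve 3 (λ p q r → r :- p :- q := r :- (p :+ q)) refl p q r) (p≤q⇒0≤q-p h)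

p≤r-q⇒q≤r-p : ∀ {p q r} → p ≤ r - q → q ≤ r - p
p≤r-q⇒q≤r-p {p} {q} {r} h = ≤-via-difference (r - q - p)
  (solve 3 (λ p q r → r :- p :- q := r :- q :- p) refl p q r) (p≤q⇒0≤q-p h)

q≤r-p⇒p+q≤r : ∀ {p q r} → q ≤ r - p → p + q ≤ r
q≤r-p⇒p+q≤r {p} {q} {r} h = ≤-via-difference (r - p - q)
  (solve 3 (λ p q r → r :- (p :+ q) := r :- p :- q) refl p q r) (p≤q⇒0≤q-p h)

p≤r-q⇒p+q≤r : ∀ {p q r} → p ≤ r - q → p + q ≤ r
p≤r-q⇒p+q≤r {p} {q} {r} h = ≤-via-difference (r - q - p)
  (solve 3 (λ p q r → r :- (p :+ q) := r :- q :- p) refl p q r) (p≤q⇒0≤q-p h)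

p-q≤0⇒p≤q : ∀ {p q} → p - q ≤ 0ℚ → p ≤ q
p-q≤0⇒p≤q {p} {q} p-q≤0 = ≤-via-difference (0ℚ - (p - q))
  (solve 2 (λ p q → q :- p := con 0ℚ :- (p :- q)) refl p q) (p≤q⇒0≤q-p p-q≤0)

1/pos : (r : ℚ) → 0ℚ < r → ℚ
1/pos r 0<r = (1/ r) {{pos⇒nonZero r {{positive 0<r}}}}

*-1/pos : ∀ r (0<r : 0ℚ < r) → r * 1/pos r 0<r ≡ 1ℚ
*-1/pos r 0<r = *-inverseʳ r {{pos⇒nonZero r {{positive 0<r}}}}

1/pos-nonNeg : ∀ r (0<r : 0ℚ < r) → 0ℚ ≤ 1/pos r 0<r
1/pos-nonNeg r 0<r = <⇒≤ (positive⁻¹ _ {{1/pos⇒pos r {{positive 0<r}}}})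

*-1/pos-cancel : ∀ r (0<r : 0ℚ < r) p → r * (p * 1/pos r 0<r) ≡ p
*-1/pos-cancel r 0<r p = begin
  r * (p * s)  ≡⟨ solve 3 (λ r p s → r :* (p :* s) := p :* (r :* s)) refl r p s ⟩
  p * (r * s)  ≡⟨ cong (p *_) (*-1/pos r 0<r) ⟩
  p * 1ℚ       ≡⟨ *-identityʳ p ⟩
  p            ∎
  where open ≡-Reasoning
        s = 1/pos r 0<r

sumℚ-cong : ∀ {n} {f g : Fin n → ℚ} → (∀ i → f i ≡ g i) → sumℚ f ≡ sumℚ g
sumℚ-cong {zero}  f≗g = refl
sumℚ-cong {suc n} f≗g = cong₂ _+_ (f≗g zero) (sumℚ-cong (λ i → f≗g (suc i)))

sumℚ-mono : ∀ {n} {f g : Fin n → ℚ} → (∀ i → f i ≤ g i) → sumℚ f ≤ sumℚ g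
sumℚ-mono {zero}  f≤g = ≤-refl
sumℚ-mono {suc n} f≤g = +-mono-≤ (f≤g zero) (sumℚ-mono (λ i → f≤g (suc i)))

sumℚ-nonNeg : ∀ {n} {f : Fin n → ℚ} → (∀ i → 0ℚ ≤ f i) → 0ℚ ≤ sumℚ f
sumℚ-nonNeg {zero}  0≤f = ≤-refl
sumℚ-nonNeg {suc n} 0≤f = +-nonNeg (0≤f zero) (sumℚ-nonNeg (λ i → 0≤f (suc i)))

sumℚ-zero : ∀ {n} {f : Fin n → ℚ} → (∀ i → f i ≡ 0ℚ) → sumℚ f ≡ 0ℚ
sumℚ-zero {zero}  f≗0 = refl
sumℚ-zero {suc n} f≗0 = cong₂ _+_ (f≗0 zero) (sumℚ-zero (λ i → f≗0 (suc i)))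

sumℚ-distrib-- : ∀ {n} (f g : Fin n → ℚ) → sumℚ (λ i → f i - g i) ≡ sumℚ f - sumℚ g
sumℚ-distrib-- {zero}  f g = refl
sumℚ-distrib-- {suc n} f g = begin
  f zero - g zero + sumℚ (λ i → f (suc i) - g (suc i))
    ≡⟨ cong (f zero - g zero +_) (sumℚ-distrib-- (λ i → f (suc i)) (λ i → g (suc i))) ⟩
  f zero - g zero + (sumℚ (λ i → f (suc i)) - sumℚ (λ i → g (suc i)))
    ≡⟨ solve 4 (λ a b c d → a :- b :+ (c :- d) := a :+ c :- (b :+ d)) refl (f zero) (g zero) _ _ ⟩
  f zero + sumℚ (λ i → f (suc i)) - (g zero + sumℚ (λ i → g (suc i))) ∎
  where open ≡-Reasoning

sumℚ-distrib-+ : ∀ {n} (f g : Fin n → ℚ) → sumℚ (λ i → f i + g i) ≡ sumℚ f + sumℚ g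
sumℚ-distrib-+ {zero}  f g = refl
sumℚ-distrib-+ {suc n} f g =
  trans (cong (f zero + g zero +_) (sumℚ-distrib-+ (λ i → f (suc i)) (λ i → g (suc i))))
        (solve 4 (λ a b c d → a :+ b :+ (c :+ d) := a :+ c :+ (b :+ d)) refl (f zero) (g zero) _ _)

*-distribˡ-sumℚ : ∀ {n} c (f : Fin n → ℚ) → c * sumℚ f ≡ sumℚ (λ i → c * f i)
*-distribˡ-sumℚ {zero}  c f = *-zeroʳ c
*-distribˡ-sumℚ {suc n} c f =
  trans (*-distribˡ-+ c (f zero) _) (cong (c * f zero +_) (*-distribˡ-sumℚ c (λ i → f (suc i))))

term≤sumℚ : ∀ {n} {f : Fin n → ℚ} → (∀ i → 0ℚ ≤ f i) → ∀ i → f i ≤ sumℚ f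
term≤sumℚ {suc n} {f} 0≤f zero =
  subst (_≤ sumℚ f) (+-identityʳ (f zero)) (+-monoʳ-≤ (f zero) (sumℚ-nonNeg (λ i → 0≤f (suc i))))
term≤sumℚ {suc n} {f} 0≤f (suc i) =
  subst (_≤ sumℚ f) (+-identityˡ (f (suc i))) (+-mono-≤ (0≤f zero) (term≤sumℚ (λ i → 0≤f (suc i)) i))

weightedMean≡max⇒support≡max : ∀ {n} (p f : Vector ℚ n) {M} → (∀ y → 0ℚ ≤ p y) → sumℚ p ≡ 1ℚ →
  (∀ y → f y ≤ M) → sumℚ (λ y → p y * f y) ≡ M → ∀ y → ¬ p y ≡ 0ℚ → f y ≡ M
weightedMean≡max⇒support≡max {n} p f {M} 0≤p Σp≡1 f≤M mean≡M y py≢0 = ≤-antisym (f≤M y) M≤fy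
  where
  open ≡-Reasoning
  Σgap≡0 : sumℚ (λ y → p y * (M - f y)) ≡ 0ℚ
  Σgap≡0 = begin
    sumℚ (λ y → p y * (M - f y))
      ≡⟨ sumℚ-cong (λ y → solve 3 (λ p M f → p :* (M :- f) := M :* p :- p :* f) refl (p y) M (f y)) ⟩
    sumℚ (λ y → M * p y - p y * f y)
      ≡⟨ sumℚ-distrib-- (λ y → M * p y) (λ y → p y * f y) ⟩
    sumℚ (λ y → M * p y) - sumℚ (λ y → p y * f y)
      ≡⟨ cong₂ _-_ (sym (*-distribˡ-sumℚ M p)) mean≡M ⟩
    M * sumℚ p - M
      ≡⟨ cong (λ s → M * s - M) Σp≡1 ⟩
    M * 1ℚ - M
      ≡⟨ solve 1 (λ M → M :* con 1ℚ :- M := con 0ℚ) refl M ⟩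
    0ℚ ∎
  gap≤0 : p y * (M - f y) ≤ p y * 0ℚ
  gap≤0 = subst (p y * (M - f y) ≤_) (trans Σgap≡0 (sym (*-zeroʳ (p y))))
    (term≤sumℚ (λ y → *-nonNeg (0≤p y) (p≤q⇒0≤q-p (f≤M y))) y)
  M≤fy : M ≤ f y
  M≤fy = p-q≤0⇒p≤q (*-cancelˡ-≤-pos (p y)
    {{nonNeg∧nonZero⇒pos (p y) {{nonNegative (0≤p y)}} {{≢-nonZero py≢0}}}} gap≤0)

maximizer : ∀ {n} (f : Fin n → ℚ) → Fin n → Σ (Fin n) λ m → ∀ z → f z ≤ f m
maximizer {n} f x = argmax f x (allFin n) , λ z → All.lookup (f[xs]≤f[argmax] x (allFin n)) (∈-allFin z)

-- Geometric series

fromℕ : ℕ → ℚ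
fromℕ zero    = 0ℚ
fromℕ (suc m) = 1ℚ + fromℕ m

fromℕ-nonNeg : ∀ m → 0ℚ ≤ fromℕ m
fromℕ-nonNeg zero    = ≤-refl
fromℕ-nonNeg (suc m) = +-nonNeg 0≤1 (fromℕ-nonNeg m)

toℚᵘ-fromℕ : ∀ m → toℚᵘ (fromℕ m) ℚᵘ.≃ ℚᵘ.mkℚᵘ (ℤ.+ m) 0
toℚᵘ-fromℕ zero    = ℚᵘ.≃-refl
toℚᵘ-fromℕ (suc m) = ℚᵘ.≃-trans (toℚᵘ-homo-+ 1ℚ (fromℕ m))
  (ℚᵘ.≃-trans (ℚᵘ.+-congʳ (toℚᵘ 1ℚ) (toℚᵘ-fromℕ m)) (ℚᵘ.*≡* 1+m≡1+m))
  where
  open ℤ using (+_)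
  1+m≡1+m : ((+ 1) ℤ.+ (+ m) ℤ.* (+ 1)) ℤ.* (+ 1) ≡ (+ suc m) ℤ.* (+ 1)
  1+m≡1+m = trans (ℤₚ.*-identityʳ _)
    (trans (cong (λ k → (+ 1) ℤ.+ k) (ℤₚ.*-identityʳ (+ m))) (sym (ℤₚ.*-identityʳ _)))

<-fromℕ : ∀ p → ∃ λ N → p < fromℕ N
<-fromℕ p@(mkℚ n d _) = N , toℚᵘ-cancel-< (ℚᵘ.<-respʳ-≃ (ℚᵘ.≃-sym (toℚᵘ-fromℕ N)) (ℚᵘ.*<* n<N*d))
  where
  open ℤ using (+_)
  open ℤₚ.≤-Reasoning
  N = suc ℤ.∣ n ∣
  i≤+∣i∣ : ∀ i → i ℤ.≤ + ℤ.∣ i ∣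
  i≤+∣i∣ (+ k)      = ℤₚ.≤-refl
  i≤+∣i∣ ℤ.-[1+ k ] = ℤ.-≤+
  n<N*d : n ℤ.* + 1 ℤ.< + N ℤ.* + suc d
  n<N*d = begin-strict
    n ℤ.* + 1          ≡⟨ ℤₚ.*-identityʳ n ⟩
    n                  ≤⟨ i≤+∣i∣ n ⟩
    + ℤ.∣ n ∣          <⟨ ℤ.+<+ ℕₚ.≤-refl ⟩
    + N                ≤⟨ ℤ.+≤+ (ℕₚ.m≤m*n N (suc d)) ⟩
    + (N ℕ.* suc d)    ≡⟨ ℤₚ.pos-* N (suc d) ⟩
    + N ℤ.* + suc d    ∎

archimedean : ∀ {ε} → 0ℚ < ε → ∀ p → ∃ λ N → p < fromℕ N * ε
archimedean {ε} 0<ε p = N , subst (_< fromℕ N * ε) p/ε*ε≡p (*-monoˡ-<-pos ε {{positive 0<ε}} p/ε<N)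
  where
  p/ε = p * 1/pos ε 0<ε
  N = proj₁ (<-fromℕ p/ε)
  p/ε<N = proj₂ (<-fromℕ p/ε)
  p/ε*ε≡p : p/ε * ε ≡ p
  p/ε*ε≡p = trans (*-comm p/ε ε) (*-1/pos-cancel ε 0<ε p)

_^_ : ℚ → ℕ → ℚ
p ^ zero  = 1ℚ
p ^ suc m = p * p ^ m

geometricSum : ℚ → ℕ → ℚ
geometricSum p zero    = 0ℚ
geometricSum p (suc m) = 1ℚ + p * geometricSum p m

module GeometricSeries (p : ℚ) (0≤p : 0ℚ ≤ p) (p<1 : p < 1ℚ) where

  r : ℚ
  r = 1ℚ - p

  0<r : 0ℚ < r
  0<r = p<q⇒0<q-p p<1

  q : ℚ
  q = 1/pos r 0<r

  0≤q : 0ℚ ≤ q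
  0≤q = 1/pos-nonNeg r 0<r

  1+p*q≡q : 1ℚ + p * q ≡ q
  1+p*q≡q = begin
    1ℚ + p * q        ≡⟨ cong (_+ p * q) (sym (*-1/pos r 0<r)) ⟩
    r * q + p * q     ≡⟨ solve 2 (λ p q → (con 1ℚ :- p) :* q :+ p :* q := q) refl p q ⟩
    q                 ∎
    where open ≡-Reasoning

  x≤r*y⇒q*x≤y : ∀ {x y} → x ≤ r * y → q * x ≤ y
  x≤r*y⇒q*x≤y {x} {y} x≤ry = subst (q * x ≤_) q*[r*y]≡y (*-monoˡ-≤-0≤ q 0≤q x≤ry)
    where
    q*[r*y]≡y : q * (r * y) ≡ y
    q*[r*y]≡y = trans (solve 3 (λ q r y → q :* (r :* y) := r :* (y :* q)) refl q r y)
                      (*-1/pos-cancel r 0<r y)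

  q*x≤y⇒x≤r*y : ∀ {x y} → q * x ≤ y → x ≤ r * y
  q*x≤y⇒x≤r*y {x} {y} qx≤y = subst (_≤ r * y) r*[q*x]≡x (*-monoˡ-≤-0≤ r (<⇒≤ 0<r) qx≤y)
    where
    r*[q*x]≡x : r * (q * x) ≡ x
    r*[q*x]≡x = trans (cong (r *_) (*-comm q x)) (*-1/pos-cancel r 0<r x)

  q-geometricSum : ∀ m → q - geometricSum p m ≡ q * p ^ m
  q-geometricSum zero    = solve 1 (λ q → q :- con 0ℚ := q :* con 1ℚ) refl q
  q-geometricSum (suc m) = begin
    q - (1ℚ + p * geometricSum p m)
      ≡⟨ solve 3 (λ q p s → q :- (con 1ℚ :+ p :* s) := p :* (q :- s) :+ (q :- (con 1ℚ :+ p :* q)))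
           refl q p (geometricSum p m) ⟩
    p * (q - geometricSum p m) + (q - (1ℚ + p * q))
      ≡⟨ cong₂ (λ a b → p * a + (q - b)) (q-geometricSum m) 1+p*q≡q ⟩
    p * (q * p ^ m) + (q - q)
      ≡⟨ solve 3 (λ q p w → p :* (q :* w) :+ (q :- q) := q :* (p :* w)) refl q p (p ^ m) ⟩
    q * (p * p ^ m) ∎
    where open ≡-Reasoning

  bernoulli : ∀ m → (1ℚ + fromℕ m * r) * p ^ m ≤ 1ℚ
  bernoulli zero    =
    ≤-reflexive (solve 1 (λ p → (con 1ℚ :+ con 0ℚ :* (con 1ℚ :- p)) :* con 1ℚ := con 1ℚ) refl p)
  bernoulli (suc m) = ≤-via-difference (p * (1ℚ - (1ℚ + fromℕ m * r) * p ^ m) + r * (1ℚ - p * p ^ m))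
    (solve 3 (λ p n w → con 1ℚ :- (con 1ℚ :+ (con 1ℚ :+ n) :* (con 1ℚ :- p)) :* (p :* w)
       := p :* (con 1ℚ :- (con 1ℚ :+ n :* (con 1ℚ :- p)) :* w) :+ (con 1ℚ :- p) :* (con 1ℚ :- p :* w))
       refl p (fromℕ m) (p ^ m))
    (+-nonNeg (*-nonNeg 0≤p (p≤q⇒0≤q-p (bernoulli m)))
              (*-nonNeg (<⇒≤ 0<r) (p≤q⇒0≤q-p (^≤1 (suc m)))))
    where
    ^≤1 : ∀ m → p ^ m ≤ 1ℚ
    ^≤1 zero    = ≤-refl
    ^≤1 (suc m) = ≤-trans (*-monoˡ-≤-0≤ p 0≤p (^≤1 m)) (subst (_≤ 1ℚ) (sym (*-identityʳ p)) (<⇒≤ p<1))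

  ^-eventually< : ∀ {K ε} → 0ℚ ≤ K → 0ℚ < ε → ∃ λ N → K * p ^ N < ε
  ^-eventually< {K} {ε} 0≤K 0<ε = N , ≰⇒> ε≰Kpᴺ
    where
    archimedes = archimedean (positive⁻¹ _ {{pos*pos⇒pos ε {{positive 0<ε}} r {{positive 0<r}}}}) K
    N = proj₁ archimedes
    ε≰Kpᴺ : ¬ ε ≤ K * p ^ N
    ε≰Kpᴺ ε≤Kpᴺ = <-irrefl refl (<-≤-trans (proj₂ archimedes) Nεr≤K)
      where
      open ≤-Reasoning
      ε[1+Nr]≤K : ε * (1ℚ + fromℕ N * r) ≤ K
      ε[1+Nr]≤K = begin
        ε * (1ℚ + fromℕ N * r)         ≤⟨ *-monoʳ-≤-nonNeg _ {{nonNegative 0≤1+Nr}} ε≤Kpᴺ ⟩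
        K * p ^ N * (1ℚ + fromℕ N * r) ≡⟨ solve 3 (λ K w b → K :* w :* b := K :* (b :* w)) refl K (p ^ N) _ ⟩
        K * ((1ℚ + fromℕ N * r) * p ^ N) ≤⟨ *-monoˡ-≤-0≤ K 0≤K (bernoulli N) ⟩
        K * 1ℚ                         ≡⟨ *-identityʳ K ⟩
        K                              ∎
        where 0≤1+Nr = +-nonNeg 0≤1 (*-nonNeg (fromℕ-nonNeg N) (<⇒≤ 0<r))
      Nεr≤K : fromℕ N * (ε * r) ≤ K
      Nεr≤K = ≤-via-difference ((K - ε * (1ℚ + fromℕ N * r)) + ε)
        (solve 4 (λ n e r K → K :- n :* (e :* r) := (K :- e :* (con 1ℚ :+ n :* r)) :+ e) refl (fromℕ N) ε r K)
        (+-nonNeg (p≤q⇒0≤q-p ε[1+Nr]≤K) (<⇒≤ 0<ε))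

  geometricSum-sup : ∀ {t w} → 0ℚ ≤ t → (∀ m → t * geometricSum p m ≤ w) → t * q ≤ w
  geometricSum-sup {t} {w} 0≤t partial≤w with t * q ≤? w
  ... | yes tq≤w = tq≤w
  ... | no  tq≰w = ⊥-elim (<-irrefl refl (<-≤-trans (proj₂ decay) ε≤tail))
    where
    ε = t * q - w
    decay = ^-eventually< (*-nonNeg 0≤t 0≤q) (p<q⇒0<q-p (≰⇒> tq≰w))
    N = proj₁ decay
    ε≤tail : ε ≤ t * q * p ^ N
    ε≤tail = ≤-via-difference (w - t * geometricSum p N)
      (begin
        t * q * p ^ N - ε
          ≡⟨ cong (_- ε) (trans (*-assoc t q (p ^ N)) (cong (t *_) (sym (q-geometricSum N)))) ⟩
        t * (q - geometricSum p N) - ε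
          ≡⟨ solve 4 (λ t q s w → t :* (q :- s) :- (t :* q :- w) := w :- t :* s) refl t q (geometricSum p N) w ⟩
        w - t * geometricSum p N ∎)
      (p≤q⇒0≤q-p (partial≤w N))
      where open ≡-Reasoning

-- Least solutions of nonnegative affine systems

Matrix : ℕ → Set
Matrix n = Vector (Vector ℚ n) n

0ᵥ : ∀ {n} → Vector ℚ n
0ᵥ _ = 0ℚ

infix 4 _≤ᵥ_
_≤ᵥ_ : ∀ {n} → Vector ℚ n → Vector ℚ n → Set
a ≤ᵥ b = ∀ x → a x ≤ b x

affine : ∀ {n} → Vector ℚ n → Matrix n → Vector ℚ n → Vector ℚ n
affine c P a x = c x + sumℚ (λ y → P x y * a y)

orbit : ∀ {n} → Vector ℚ n → Matrix n → Vector ℚ n → ℕ → Vector ℚ n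
orbit c P a zero    = a
orbit c P a (suc k) = affine c P (orbit c P a k)

iterates : ∀ {n} → Vector ℚ n → Matrix n → ℕ → Vector ℚ n
iterates c P = orbit c P 0ᵥ

module _ {n} (s : ℕ → Vector ℚ n) where

  Monotone : Set
  Monotone = ∀ k → s k ≤ᵥ s (suc k)

  IsUpperBound : Vector ℚ n → Set
  IsUpperBound u = ∀ k → s k ≤ᵥ u

  -- a ≤ sup s pointwise, stated without the supremum, which need not exist in ℚ.
  IsBelowSup : Vector ℚ n → Set
  IsBelowSup a = ∀ x w → (∀ k → s k x ≤ w) → a x ≤ w

  IsSup : Vector ℚ n → Set
  IsSup u = IsUpperBound u × IsBelowSup u

monotone⇒≤ : ∀ {n} {s : ℕ → Vector ℚ n} → Monotone s → ∀ {j k} → j ℕ.≤ k → s j ≤ᵥ s k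
monotone⇒≤ {s = s} s-mono j≤k = go (ℕₚ.≤⇒≤′ j≤k)
  where
  go : ∀ {j k} → j ℕ.≤′ k → s j ≤ᵥ s k
  go ℕ.≤′-refl         x = ≤-refl
  go (ℕ.≤′-step j≤′k) x = ≤-trans (go j≤′k x) (s-mono _ x)

isBelowSup-mono : ∀ {n} {s : ℕ → Vector ℚ n} {a b} → a ≤ᵥ b → IsBelowSup s b → IsBelowSup s a
isBelowSup-mono a≤b b-below x w s≤w = ≤-trans (a≤b x) (b-below x w s≤w)

isSup-cong : ∀ {n} {s t : ℕ → Vector ℚ n} {u} → (∀ k x → s k x ≡ t k x) → IsSup s u → IsSup t u
isSup-cong {u = u} s≗t (u-ub , u-below) =
  (λ k x → subst (_≤ u x) (s≗t k x) (u-ub k x)) ,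
  (λ x w t≤w → u-below x w (λ k → subst (_≤ w) (sym (s≗t k x)) (t≤w k)))

*-belowSup : ∀ {r t w} (s : ℕ → ℚ) → 0ℚ ≤ r → (∀ w′ → (∀ k → s k ≤ w′) → t ≤ w′) →
  (∀ k → r * s k ≤ w) → r * t ≤ w
*-belowSup {r} {t} {w} s 0≤r t-below rs≤w with 0ℚ <? r
... | yes 0<r = subst (r * t ≤_) (*-1/pos-cancel r 0<r w) (*-monoˡ-≤-0≤ r 0≤r (t-below _ s≤w/r))
  where
  s≤w/r : ∀ k → s k ≤ w * 1/pos r 0<r
  s≤w/r k = *-cancelˡ-≤-pos r {{positive 0<r}} (subst (r * s k ≤_) (sym (*-1/pos-cancel r 0<r w)) (rs≤w k))
... | no  0≮r = subst (_≤ w) (trans (rx≡0 (s 0)) (sym (rx≡0 t))) (rs≤w 0)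
  where
  rx≡0 : ∀ x → r * x ≡ 0ℚ
  rx≡0 x = trans (cong (_* x) (≤-antisym (≮⇒≥ 0≮r) 0≤r)) (*-zeroˡ x)

-- Σ_z Q_z sup_k s_k z ≤ sup_k Σ_z Q_z s_k z; monotonicity lets all coordinates share one index k.
sumℚ-belowSup : ∀ {n} {s : ℕ → Vector ℚ n} {t} → Monotone s → IsBelowSup s t →
  ∀ (Q : Vector ℚ n) {W} → 0ᵥ ≤ᵥ Q → (∀ k → sumℚ (λ z → Q z * s k z) ≤ W) → sumℚ (λ z → Q z * t z) ≤ W
sumℚ-belowSup {zero}          s-mono t-below Q 0≤Q Σ≤W = Σ≤W 0
sumℚ-belowSup {suc m} {s} {t} s-mono t-below Q {W} 0≤Q Σ≤W = p≤r-q⇒p+q≤r head≤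
  where
  head : ℕ → ℚ
  head k = Q zero * s k zero
  rest : ℕ → ℚ
  rest k = sumℚ (λ z → Q (suc z) * s k (suc z))
  restₜ = sumℚ (λ z → Q (suc z) * t (suc z))
  head+rest≤W : ∀ j k → head j + rest k ≤ W
  head+rest≤W j k = ≤-trans
    (+-mono-≤ (*-monoˡ-≤-0≤ (Q zero) (0≤Q zero) (monotone⇒≤ s-mono (ℕₚ.m≤m⊔n j k) zero))
              (sumℚ-mono (λ z → *-monoˡ-≤-0≤ (Q (suc z)) (0≤Q (suc z))
                                  (monotone⇒≤ s-mono (ℕₚ.m≤n⊔m j k) (suc z)))))
    (Σ≤W (j ℕ.⊔ k))
  restₜ≤ : ∀ j → restₜ ≤ W - head j
  restₜ≤ j = sumℚ-belowSup (λ k z → s-mono k (suc z)) (λ z → t-below (suc z))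
    (λ z → Q (suc z)) (λ z → 0≤Q (suc z)) (λ k → p+q≤r⇒q≤r-p (head+rest≤W j k))
  head≤ : Q zero * t zero ≤ W - restₜ
  head≤ = *-belowSup (λ k → s k zero) (0≤Q zero) (t-below zero) (λ k → p≤r-q⇒q≤r-p {r = W} (restₜ≤ k))

module AffineSystem {n} (c : Vector ℚ n) (P : Matrix n) (0≤c : 0ᵥ ≤ᵥ c) (0≤P : ∀ x → 0ᵥ ≤ᵥ P x) where

  affine-mono : ∀ {a b} → a ≤ᵥ b → affine c P a ≤ᵥ affine c P b
  affine-mono a≤b x = +-monoʳ-≤ (c x) (sumℚ-mono (λ y → *-monoˡ-≤-0≤ (P x y) (0≤P x y) (a≤b y)))

  affine-nonNeg : ∀ {a} → 0ᵥ ≤ᵥ a → 0ᵥ ≤ᵥ affine c P a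
  affine-nonNeg 0≤a x = +-nonNeg (0≤c x) (sumℚ-nonNeg (λ y → *-nonNeg (0≤P x y) (0≤a y)))

  iterates-nonNeg : ∀ k → 0ᵥ ≤ᵥ iterates c P k
  iterates-nonNeg zero    x = ≤-refl
  iterates-nonNeg (suc k) = affine-nonNeg (iterates-nonNeg k)

  orbit-monotone : ∀ {a} → a ≤ᵥ affine c P a → Monotone (orbit c P a)
  orbit-monotone a-sub zero    = a-sub
  orbit-monotone a-sub (suc k) = affine-mono (orbit-monotone a-sub k)

  iterates-monotone : Monotone (iterates c P)
  iterates-monotone = orbit-monotone (iterates-nonNeg 1)

  iterates≤superSolution : ∀ {b} → 0ᵥ ≤ᵥ b → affine c P b ≤ᵥ b → IsUpperBound (iterates c P) b
  iterates≤superSolution 0≤b b-super zero    = 0≤b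
  iterates≤superSolution 0≤b b-super (suc k) x =
    ≤-trans (affine-mono (iterates≤superSolution 0≤b b-super k) x) (b-super x)

  affine-belowSup : ∀ {a} → IsBelowSup (iterates c P) a → IsBelowSup (iterates c P) (affine c P a)
  affine-belowSup a-below x w shifted≤w = q≤r-p⇒p+q≤r {c x}
    (sumℚ-belowSup iterates-monotone a-below (P x) (0≤P x) (λ k → p+q≤r⇒q≤r-p {c x} (shifted≤w (suc k))))

  orbit-belowSup : ∀ {a} → IsBelowSup (iterates c P) a → ∀ j → IsBelowSup (iterates c P) (orbit c P a j)
  orbit-belowSup a-below zero    = a-below
  orbit-belowSup a-below (suc j) = affine-belowSup (orbit-belowSup a-below j)

  sup-nonNeg : ∀ {u} → IsSup (iterates c P) u → 0ᵥ ≤ᵥ u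
  sup-nonNeg u-sup = proj₁ u-sup 0

  sup-fixedPoint : ∀ {u} → IsSup (iterates c P) u → ∀ x → u x ≡ affine c P u x
  sup-fixedPoint {u} (u-ub , u-below) x =
    ≤-antisym (u-below x _ iterates≤affine-u) (affine-belowSup u-below x (u x) (λ k → u-ub k x))
    where
    iterates≤affine-u : ∀ k → iterates c P k x ≤ affine c P u x
    iterates≤affine-u zero    = affine-nonNeg (u-ub 0) x
    iterates≤affine-u (suc k) = affine-mono (u-ub k) x

  sup≤superSolution : ∀ {u b} → IsSup (iterates c P) u → 0ᵥ ≤ᵥ b → affine c P b ≤ᵥ b → u ≤ᵥ b
  sup≤superSolution (_ , u-below) 0≤b b-super x = u-below x _ (λ k → iterates≤superSolution 0≤b b-super k x)

SupExists : ℕ → Set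
SupExists n = ∀ (c : Vector ℚ n) (P : Matrix n) → 0ᵥ ≤ᵥ c → (∀ x → 0ᵥ ≤ᵥ P x) →
  ∀ b → 0ᵥ ≤ᵥ b → affine c P b ≤ᵥ b → Σ (Vector ℚ n) (IsSup (iterates c P))

-- For P₀₀ < 1, the first equation gives x₀ = q (c₀ + Σ_z P₀z x_z) with q = 1/(1 − P₀₀); substituting
-- it into the other rows gives the reduced system (cᵣ, Pᵣ), whose supremum lifts to the full one.
module EliminateFirst {m} (c : Vector ℚ (suc m)) (P : Matrix (suc m))
    (0≤c : 0ᵥ ≤ᵥ c) (0≤P : ∀ x → 0ᵥ ≤ᵥ P x)
    (b : Vector ℚ (suc m)) (0≤b : 0ᵥ ≤ᵥ b) (b-super : affine c P b ≤ᵥ b)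
    (P₀₀<1 : P zero zero < 1ℚ) (sup-exists : SupExists m) where

  open AffineSystem c P 0≤c 0≤P

  p : ℚ
  p = P zero zero

  open GeometricSeries p (0≤P zero zero) P₀₀<1

  firstRow : Vector ℚ m → ℚ
  firstRow a = c zero + sumℚ (λ z → P zero (suc z) * a z)

  lift : Vector ℚ m → Vector ℚ (suc m)
  lift a = q * firstRow a ∷ a

  cᵣ : Vector ℚ m
  cᵣ y = c (suc y) + P (suc y) zero * (q * c zero)

  Pᵣ : Matrix m
  Pᵣ y z = P (suc y) (suc z) + P (suc y) zero * (q * P zero (suc z))

  0≤cᵣ : 0ᵥ ≤ᵥ cᵣ
  0≤cᵣ y = +-nonNeg (0≤c (suc y)) (*-nonNeg (0≤P (suc y) zero) (*-nonNeg 0≤q (0≤c zero)))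

  0≤Pᵣ : ∀ y → 0ᵥ ≤ᵥ Pᵣ y
  0≤Pᵣ y z = +-nonNeg (0≤P (suc y) (suc z)) (*-nonNeg (0≤P (suc y) zero) (*-nonNeg 0≤q (0≤P zero (suc z))))

  affine-lift-zero : ∀ a → affine c P (lift a) zero ≡ lift a zero
  affine-lift-zero a = begin
    c zero + (p * (q * firstRow a) + S)
      ≡⟨ solve 4 (λ c₀ p q S → c₀ :+ (p :* (q :* (c₀ :+ S)) :+ S) := (con 1ℚ :+ p :* q) :* (c₀ :+ S))
           refl (c zero) p q S ⟩
    (1ℚ + p * q) * firstRow a
      ≡⟨ cong (_* firstRow a) 1+p*q≡q ⟩
    q * firstRow a ∎
    where
    open ≡-Reasoning
    S = sumℚ (λ z → P zero (suc z) * a z)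

  affine-lift-suc : ∀ a y → affine cᵣ Pᵣ a y ≡ affine c P (lift a) (suc y)
  affine-lift-suc a y = begin
    cᵣ y + sumℚ (λ z → Pᵣ y z * a z)
      ≡⟨ cong (cᵣ y +_) (sumℚ-cong expand) ⟩
    cᵣ y + sumℚ (λ z → Pₓ₀ * q * (P zero (suc z) * a z) + P (suc y) (suc z) * a z)
      ≡⟨ cong (cᵣ y +_) (sumℚ-distrib-+ (λ z → Pₓ₀ * q * (P zero (suc z) * a z)) (λ z → P (suc y) (suc z) * a z))
       ⟩
    cᵣ y + (sumℚ (λ z → Pₓ₀ * q * (P zero (suc z) * a z)) + A)
      ≡⟨ cong (λ s → cᵣ y + (s + A)) (sym (*-distribˡ-sumℚ (Pₓ₀ * q) (λ z → P zero (suc z) * a z))) ⟩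
    cᵣ y + (Pₓ₀ * q * S + A)
      ≡⟨ solve 6 (λ cₓ B q c₀ A S → cₓ :+ B :* (q :* c₀) :+ (B :* q :* S :+ A)
                                   := cₓ :+ (B :* (q :* (c₀ :+ S)) :+ A)) refl (c (suc y)) Pₓ₀ q (c zero) A S ⟩
    c (suc y) + (Pₓ₀ * (q * firstRow a) + A) ∎
    where
    open ≡-Reasoning
    Pₓ₀ = P (suc y) zero
    A = sumℚ (λ z → P (suc y) (suc z) * a z)
    S = sumℚ (λ z → P zero (suc z) * a z)
    expand : ∀ z → Pᵣ y z * a z ≡ Pₓ₀ * q * (P zero (suc z) * a z) + P (suc y) (suc z) * a z
    expand z = solve 5 (λ A B q C x → (A :+ B :* (q :* C)) :* x := B :* q :* (C :* x) :+ A :* x)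
                 refl (P (suc y) (suc z)) Pₓ₀ q (P zero (suc z)) (a z)

  firstRow-nonNeg : ∀ {a} → 0ᵥ ≤ᵥ a → 0ℚ ≤ firstRow a
  firstRow-nonNeg 0≤a = +-nonNeg (0≤c zero) (sumℚ-nonNeg (λ z → *-nonNeg (0≤P zero (suc z)) (0≤a z)))

  firstRow-mono : ∀ {a a′} → a ≤ᵥ a′ → firstRow a ≤ firstRow a′
  firstRow-mono a≤a′ =
    +-monoʳ-≤ (c zero) (sumℚ-mono (λ z → *-monoˡ-≤-0≤ (P zero (suc z)) (0≤P zero (suc z)) (a≤a′ z)))

  lift-nonNeg : ∀ {a} → 0ᵥ ≤ᵥ a → 0ᵥ ≤ᵥ lift a
  lift-nonNeg 0≤a zero    = *-nonNeg 0≤q (firstRow-nonNeg 0≤a)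
  lift-nonNeg 0≤a (suc z) = 0≤a z

  lift-mono : ∀ {a a′} → a ≤ᵥ a′ → lift a ≤ᵥ lift a′
  lift-mono a≤a′ zero    = *-monoˡ-≤-0≤ q 0≤q (firstRow-mono a≤a′)
  lift-mono a≤a′ (suc z) = a≤a′ z

  lift-tail-superSolution : ∀ {a} → affine c P a ≤ᵥ a → lift (tail a) ≤ᵥ a
  lift-tail-superSolution {a} a-super zero = x≤r*y⇒q*x≤y (≤-via-difference (a zero - affine c P a zero)
    (solve 4 (λ c₀ p a₀ S → (con 1ℚ :- p) :* a₀ :- (c₀ :+ S) := a₀ :- (c₀ :+ (p :* a₀ :+ S)))
       refl (c zero) p (a zero) (sumℚ (λ z → P zero (suc z) * a (suc z))))
    (p≤q⇒0≤q-p (a-super zero)))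
  lift-tail-superSolution a-super (suc y) = ≤-refl

  -- Iterating affine from a, the first coordinate grows at least like t (1 + p + ⋯ + pʲ⁻¹),
  -- where t = firstRow (tail a); so lift (tail a) 0 = q t is still below the supremum.
  lift-tail-belowSup : ∀ {a} → IsBelowSup (iterates c P) a → 0ᵥ ≤ᵥ a → a ≤ᵥ affine c P a →
    IsBelowSup (iterates c P) (lift (tail a))
  lift-tail-belowSup {a} a-below 0≤a a-sub zero w iterates≤w =
    subst (_≤ w) (*-comm t q) (geometricSum-sup (firstRow-nonNeg (λ z → 0≤a (suc z)))
      (λ j → ≤-trans (geometric≤orbit j) (orbit-belowSup a-below j zero w iterates≤w)))
    where
    t = firstRow (tail a)
    geometric≤orbit : ∀ j → t * geometricSum p j ≤ orbit c P a j zero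
    geometric≤orbit zero    = subst (_≤ a zero) (sym (*-zeroʳ t)) (0≤a zero)
    geometric≤orbit (suc j) = subst (_≤ orbit c P a (suc j) zero) (sym unfold)
      (+-monoʳ-≤ (c zero) (+-mono-≤ (*-monoˡ-≤-0≤ p (0≤P zero zero) (geometric≤orbit j))
        (sumℚ-mono (λ z → *-monoˡ-≤-0≤ (P zero (suc z)) (0≤P zero (suc z))
          (monotone⇒≤ (orbit-monotone a-sub) {0} {j} ℕ.z≤n (suc z))))))
      where
      S = sumℚ (λ z → P zero (suc z) * a (suc z))
      unfold : t * (1ℚ + p * geometricSum p j) ≡ c zero + (p * (t * geometricSum p j) + S)
      unfold = solve 4 (λ c₀ S p s → (c₀ :+ S) :* (con 1ℚ :+ p :* s) := c₀ :+ (p :* ((c₀ :+ S) :* s) :+ S))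
                 refl (c zero) S p (geometricSum p j)
  lift-tail-belowSup a-below 0≤a a-sub (suc y) = a-below (suc y)

  module Reduced = AffineSystem cᵣ Pᵣ 0≤cᵣ 0≤Pᵣ

  lift-iterates-belowSup : ∀ k → IsBelowSup (iterates c P) (lift (iterates cᵣ Pᵣ k))
  lift-iterates-belowSup zero =
    lift-tail-belowSup (λ x w iterates≤w → iterates≤w 0) (λ _ → ≤-refl) (iterates-nonNeg 1)
  lift-iterates-belowSup (suc k) = isBelowSup-mono (lift-mono (λ y → ≤-reflexive (affine-lift-suc aᵣ y)))
    (lift-tail-belowSup (affine-belowSup (lift-iterates-belowSup k))
      (affine-nonNeg (lift-nonNeg (Reduced.iterates-nonNeg k))) (affine-mono lift-sub))
    where
    aᵣ = iterates cᵣ Pᵣ k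
    lift-sub : lift aᵣ ≤ᵥ affine c P (lift aᵣ)
    lift-sub zero    = ≤-reflexive (sym (affine-lift-zero aᵣ))
    lift-sub (suc y) = subst (aᵣ y ≤_) (affine-lift-suc aᵣ y) (Reduced.iterates-monotone k y)

  tail-b-super : affine cᵣ Pᵣ (tail b) ≤ᵥ tail b
  tail-b-super y = subst (_≤ b (suc y)) (sym (affine-lift-suc (tail b) y))
    (≤-trans (affine-mono (lift-tail-superSolution b-super) (suc y)) (b-super (suc y)))

  sup : Σ (Vector ℚ (suc m)) (IsSup (iterates c P))
  sup = lift uᵣ , iterates≤superSolution (lift-nonNeg (Reduced.sup-nonNeg uᵣ-sup)) lift-super , lift-below
    where
    reduced = sup-exists cᵣ Pᵣ 0≤cᵣ 0≤Pᵣ (tail b) (λ y → 0≤b (suc y)) tail-b-super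
    uᵣ = proj₁ reduced
    uᵣ-sup = proj₂ reduced
    lift-super : affine c P (lift uᵣ) ≤ᵥ lift uᵣ
    lift-super zero    = ≤-reflexive (affine-lift-zero uᵣ)
    lift-super (suc y) =
      ≤-reflexive (trans (sym (affine-lift-suc uᵣ y)) (sym (Reduced.sup-fixedPoint uᵣ-sup y)))
    lift-below : IsBelowSup (iterates c P) (lift uᵣ)
    lift-below zero    w iterates≤w = x≤r*y⇒q*x≤y (q≤r-p⇒p+q≤r {c zero}
      (sumℚ-belowSup Reduced.iterates-monotone (proj₂ uᵣ-sup) (λ z → P zero (suc z)) (λ z → 0≤P zero (suc z))
        (λ k → p+q≤r⇒q≤r-p {c zero} (q*x≤y⇒x≤r*y (lift-iterates-belowSup k zero w iterates≤w)))))
    lift-below (suc y) w iterates≤w = proj₂ uᵣ-sup y w (λ k → lift-iterates-belowSup k (suc y) w iterates≤w)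

-- With P₀₀ ≥ 1 a nonnegative super-solution forces c₀ + Σ_z P₀z b_z ≤ 0, so every iterate
-- vanishes at 0 and replacing the first row by zero does not change the iterates.
module DegenerateFirst {m} (c : Vector ℚ (suc m)) (P : Matrix (suc m))
    (0≤c : 0ᵥ ≤ᵥ c) (0≤P : ∀ x → 0ᵥ ≤ᵥ P x)
    (b : Vector ℚ (suc m)) (0≤b : 0ᵥ ≤ᵥ b) (b-super : affine c P b ≤ᵥ b)
    (1≤P₀₀ : 1ℚ ≤ P zero zero) where

  open AffineSystem c P 0≤c 0≤P

  restᵇ : ℚ
  restᵇ = sumℚ (λ z → P zero (suc z) * b (suc z))

  c₀+restᵇ≤0 : c zero + restᵇ ≤ 0ℚ
  c₀+restᵇ≤0 = ≤-via-difference ((b zero - affine c P b zero) + (P zero zero - 1ℚ) * b zero)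
    (solve 4 (λ c₀ p b₀ S → con 0ℚ :- (c₀ :+ S) := (b₀ :- (c₀ :+ (p :* b₀ :+ S))) :+ (p :- con 1ℚ) :* b₀)
       refl (c zero) (P zero zero) (b zero) restᵇ)
    (+-nonNeg (p≤q⇒0≤q-p (b-super zero)) (*-nonNeg (p≤q⇒0≤q-p 1≤P₀₀) (0≤b zero)))

  iterates-first≡0 : ∀ k → iterates c P k zero ≡ 0ℚ
  iterates-first≡0 zero    = refl
  iterates-first≡0 (suc k) = ≤-antisym (≤-trans iterate-first≤ c₀+restᵇ≤0) (iterates-nonNeg (suc k) zero)
    where
    restₖ = sumℚ (λ z → P zero (suc z) * iterates c P k (suc z))
    iterate-first≤ : iterates c P (suc k) zero ≤ c zero + restᵇ
    iterate-first≤ = begin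
      c zero + (P zero zero * iterates c P k zero + restₖ)
        ≡⟨ cong (λ x → c zero + (P zero zero * x + restₖ)) (iterates-first≡0 k) ⟩
      c zero + (P zero zero * 0ℚ + restₖ)
        ≡⟨ cong (λ x → c zero + (x + restₖ)) (*-zeroʳ (P zero zero)) ⟩
      c zero + (0ℚ + restₖ)
        ≡⟨ cong (c zero +_) (+-identityˡ restₖ) ⟩
      c zero + restₖ
        ≤⟨ +-monoʳ-≤ (c zero) (sumℚ-mono (λ z → *-monoˡ-≤-0≤ (P zero (suc z)) (0≤P zero (suc z))
                                                    (iterates≤superSolution 0≤b b-super k (suc z)))) ⟩
      c zero + restᵇ ∎
      where open ≤-Reasoning

  c⁰ : Vector ℚ (suc m)
  c⁰ = 0ℚ ∷ tail c

  P⁰ : Matrix (suc m)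
  P⁰ = 0ᵥ ∷ tail P

  0≤c⁰ : 0ᵥ ≤ᵥ c⁰
  0≤c⁰ zero    = ≤-refl
  0≤c⁰ (suc y) = 0≤c (suc y)

  0≤P⁰ : ∀ x → 0ᵥ ≤ᵥ P⁰ x
  0≤P⁰ zero    y = ≤-refl
  0≤P⁰ (suc x) y = 0≤P (suc x) y

  affine⁰-first≡0 : ∀ a → affine c⁰ P⁰ a zero ≡ 0ℚ
  affine⁰-first≡0 a = trans (+-identityˡ _) (sumℚ-zero (λ y → *-zeroˡ (a y)))

  b-super⁰ : affine c⁰ P⁰ b ≤ᵥ b
  b-super⁰ zero    = subst (_≤ b zero) (sym (affine⁰-first≡0 b)) (0≤b zero)
  b-super⁰ (suc y) = b-super (suc y)

  iterates⁰≡iterates : ∀ k x → iterates c⁰ P⁰ k x ≡ iterates c P k x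
  iterates⁰≡iterates zero    x       = refl
  iterates⁰≡iterates (suc k) zero    =
    trans (affine⁰-first≡0 (iterates c⁰ P⁰ k)) (sym (iterates-first≡0 (suc k)))
  iterates⁰≡iterates (suc k) (suc y) =
    cong (c (suc y) +_) (sumℚ-cong (λ z → cong (P (suc y) z *_) (iterates⁰≡iterates k z)))

  P⁰₀₀<1 : P⁰ zero zero < 1ℚ
  P⁰₀₀<1 = positive⁻¹ 1ℚ

sup-exists : ∀ n → SupExists n
sup-exists zero    c P _ _ _ _ _ = (λ ()) , (λ k ()) , (λ ())
sup-exists (suc m) c P 0≤c 0≤P b 0≤b b-super with P zero zero <? 1ℚ
... | yes P₀₀<1 = EliminateFirst.sup c P 0≤c 0≤P b 0≤b b-super P₀₀<1 (sup-exists m)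
... | no  P₀₀≮1 = proj₁ sup⁰ , isSup-cong iterates⁰≡iterates (proj₂ sup⁰)
  where
  open DegenerateFirst c P 0≤c 0≤P b 0≤b b-super (≮⇒≥ P₀₀≮1)
  sup⁰ = EliminateFirst.sup c⁰ P⁰ 0≤c⁰ 0≤P⁰ b 0≤b b-super⁰ P⁰₀₀<1 (sup-exists m)

-- Plays as affine systems

unitVector : ∀ {n} → Fin n → Vector ℚ n
unitVector zero    = 1ℚ ∷ 0ᵥ
unitVector (suc j) = 0ℚ ∷ unitVector j

unitVector-nonNeg : ∀ {n} (j y : Fin n) → 0ℚ ≤ unitVector j y
unitVector-nonNeg zero    zero    = 0≤1
unitVector-nonNeg zero    (suc y) = ≤-refl
unitVector-nonNeg (suc j) zero    = ≤-refl
unitVector-nonNeg (suc j) (suc y) = unitVector-nonNeg j y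

sumℚ-unitVector : ∀ {n} (j : Fin n) (f : Vector ℚ n) → sumℚ (λ y → unitVector j y * f y) ≡ f j
sumℚ-unitVector zero f = begin
  1ℚ * f zero + sumℚ (λ y → 0ℚ * f (suc y))
    ≡⟨ cong₂ _+_ (*-identityˡ (f zero)) (sumℚ-zero (λ y → *-zeroˡ (f (suc y)))) ⟩
  f zero + 0ℚ
    ≡⟨ +-identityʳ (f zero) ⟩
  f zero ∎
  where open ≡-Reasoning
sumℚ-unitVector (suc j) f =
  trans (cong₂ _+_ (*-zeroˡ (f zero)) (sumℚ-unitVector j (λ y → f (suc y)))) (+-identityˡ (f (suc j)))

-- One step of a play is affine: a vertex's row is the unit vector of the chosen move at MAX and MIN
-- vertices, the distribution at random ones and 0 at sinks, whose value is the constant term.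
kindReward : Kind → ℚ → ℚ
kindReward SINKv value = value
kindReward _     _     = 0ℚ

kindRow : ∀ {n} → Kind → (maxMove minMove : Fin n) → Vector ℚ n → Vector ℚ n
kindRow SINKv maxMove minMove distribution = 0ᵥ
kindRow MAXv  maxMove minMove distribution = unitVector maxMove
kindRow MINv  maxMove minMove distribution = unitVector minMove
kindRow RANDv maxMove minMove distribution = distribution

kindStep : ∀ {n} → Kind → ℚ → (maxMove minMove : Fin n) → Vector ℚ n → Vector ℚ n → ℚ
kindStep k value maxMove minMove distribution a =
  kindReward k value + sumℚ (λ y → kindRow k maxMove minMove distribution y * a y)

module KindStep {n} (v : ℚ) (s t : Fin n) (pr : Vector ℚ n) where

  atSink : ∀ a → kindStep SINKv v s t pr a ≡ v
  atSink a = trans (cong (v +_) (sumℚ-zero (λ y → *-zeroˡ (a y)))) (+-identityʳ v)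

  atMax : ∀ a → kindStep MAXv v s t pr a ≡ a s
  atMax a = trans (+-identityˡ _) (sumℚ-unitVector s a)

  atMin : ∀ a → kindStep MINv v s t pr a ≡ a t
  atMin a = trans (+-identityˡ _) (sumℚ-unitVector t a)

  atRand : ∀ a → kindStep RANDv v s t pr a ≡ sumℚ (λ y → pr y * a y)
  atRand a = +-identityˡ _

module Play {n} (g : Game n) (ssg : IsSSG g) (σ : MaxStrategy g) (τ : MinStrategy g) where

  reward : Vector ℚ n
  reward x = kindReward (kind g x) (val g x)

  transition : Matrix n
  transition x = kindRow (kind g x) (proj₁ σ x) (proj₁ τ x) (prob g x)

  0≤reward : 0ᵥ ≤ᵥ reward
  0≤reward x with kind g x in eq
  ... | SINKv = IsSSG.valLow ssg x eq
  ... | MAXv  = ≤-refl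
  ... | MINv  = ≤-refl
  ... | RANDv = ≤-refl

  0≤transition : ∀ x → 0ᵥ ≤ᵥ transition x
  0≤transition x y with kind g x in eq
  ... | SINKv = ≤-refl
  ... | MAXv  = unitVector-nonNeg (proj₁ σ x) y
  ... | MINv  = unitVector-nonNeg (proj₁ τ x) y
  ... | RANDv = IsSSG.probNonneg ssg x y eq

  open AffineSystem reward transition 0≤reward 0≤transition public

  step : Vector ℚ n → Vector ℚ n
  step = affine reward transition

  module AtVertex (x : Fin n) = KindStep (val g x) (proj₁ σ x) (proj₁ τ x) (prob g x)

  step-sink : ∀ a x → kind g x ≡ SINKv → step a x ≡ val g x
  step-sink a x eq rewrite eq = AtVertex.atSink x a

  step-max : ∀ a x → kind g x ≡ MAXv → step a x ≡ a (proj₁ σ x)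
  step-max a x eq rewrite eq = AtVertex.atMax x a

  step-min : ∀ a x → kind g x ≡ MINv → step a x ≡ a (proj₁ τ x)
  step-min a x eq rewrite eq = AtVertex.atMin x a

  step-rand : ∀ a x → kind g x ≡ RANDv → step a x ≡ sumℚ (λ y → prob g x y * a y)
  step-rand a x eq rewrite eq = AtVertex.atRand x a

  step-1≤1 : step (λ _ → 1ℚ) ≤ᵥ (λ _ → 1ℚ)
  step-1≤1 x with kind g x in eq
  ... | SINKv = ≤-trans (≤-reflexive (AtVertex.atSink x (λ _ → 1ℚ))) (IsSSG.valHigh ssg x eq)
  ... | MAXv  = ≤-reflexive (AtVertex.atMax x (λ _ → 1ℚ))
  ... | MINv  = ≤-reflexive (AtVertex.atMin x (λ _ → 1ℚ))
  ... | RANDv = ≤-reflexive (trans (AtVertex.atRand x (λ _ → 1ℚ))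
                  (trans (sumℚ-cong (λ y → *-identityʳ (prob g x y))) (IsSSG.probSum ssg x eq)))

  horizon≡iterates : ∀ k x → horizon g σ τ k x ≡ iterates reward transition (suc k) x
  horizon≡iterates zero x with kind g x
  ... | SINKv = sym (AtVertex.atSink x 0ᵥ)
  ... | MAXv  = sym (AtVertex.atMax x 0ᵥ)
  ... | MINv  = sym (AtVertex.atMin x 0ᵥ)
  ... | RANDv = sym (trans (AtVertex.atRand x 0ᵥ) (sumℚ-zero (λ y → *-zeroʳ (prob g x y))))
  horizon≡iterates (suc k) x with kind g x
  ... | SINKv = sym (AtVertex.atSink x (iterates reward transition (suc k)))
  ... | MAXv  = trans (horizon≡iterates k (proj₁ σ x)) (sym (AtVertex.atMax x _))
  ... | MINv  = trans (horizon≡iterates k (proj₁ τ x)) (sym (AtVertex.atMin x _))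
  ... | RANDv =
    trans (sumℚ-cong (λ y → cong (prob g x y *_) (horizon≡iterates k y))) (sym (AtVertex.atRand x _))

  horizon≤⇒iterates≤ : ∀ {u} → (∀ k x → horizon g σ τ k x ≤ u x) →
    IsUpperBound (iterates reward transition) u
  horizon≤⇒iterates≤ {u} horizon≤u zero    x =
    ≤-trans (iterates-monotone 0 x) (subst (_≤ u x) (horizon≡iterates 0 x) (horizon≤u 0 x))
  horizon≤⇒iterates≤ {u} horizon≤u (suc k) x = subst (_≤ u x) (horizon≡iterates k x) (horizon≤u k x)

  isValue⇒isSup : ∀ {v} → IsValue g σ τ v → IsSup (iterates reward transition) v
  isValue⇒isSup {v} (horizon≤v , v-least) = horizon≤⇒iterates≤ horizon≤v , v-below
    where
    v-below : IsBelowSup (iterates reward transition) v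
    v-below x w iterates≤w = subst (v x ≤_) (updateAt-updates x v) (v-least u horizon≤u x)
      where
      u = updateAt v x (λ _ → w)
      horizon≤u : ∀ k y → horizon g σ τ k y ≤ u y
      horizon≤u k y with y Fin.≟ x
      ... | yes refl =
        subst₂ _≤_ (sym (horizon≡iterates k y)) (sym (updateAt-updates y v)) (iterates≤w (suc k))
      ... | no  y≢x  = subst (horizon g σ τ k y ≤_) (sym (updateAt-minimal y x v y≢x)) (horizon≤v k y)

  isSup⇒isValue : ∀ {v} → IsSup (iterates reward transition) v → IsValue g σ τ v
  isSup⇒isValue {v} (iterates≤v , v-below) =
    (λ k x → subst (_≤ v x) (sym (horizon≡iterates k x)) (iterates≤v (suc k) x)) ,
    (λ u horizon≤u x → v-below x (u x) (λ k → horizon≤⇒iterates≤ horizon≤u k x))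

  value : Σ (Vector ℚ n) (IsValue g σ τ)
  value = proj₁ supremum , isSup⇒isValue (proj₂ supremum)
    where
    supremum = sup-exists n reward transition 0≤reward 0≤transition (λ _ → 1ℚ) (λ _ → 0≤1) step-1≤1

  module Value {v} (v-value : IsValue g σ τ v) where

    0≤v : 0ᵥ ≤ᵥ v
    0≤v = sup-nonNeg (isValue⇒isSup v-value)

    fixedPoint : ∀ x → v x ≡ step v x
    fixedPoint = sup-fixedPoint (isValue⇒isSup v-value)

    ≤superSolution : ∀ {b} → 0ᵥ ≤ᵥ b → step b ≤ᵥ b → v ≤ᵥ b
    ≤superSolution = sup≤superSolution (isValue⇒isSup v-value)

    atSink : ∀ x → kind g x ≡ SINKv → v x ≡ val g x
    atSink x eq = trans (fixedPoint x) (step-sink v x eq)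

    atMax : ∀ x → kind g x ≡ MAXv → v x ≡ v (proj₁ σ x)
    atMax x eq = trans (fixedPoint x) (step-max v x eq)

    atMin : ∀ x → kind g x ≡ MINv → v x ≡ v (proj₁ τ x)
    atMin x eq = trans (fixedPoint x) (step-min v x eq)

    atRand : ∀ x → kind g x ≡ RANDv → v x ≡ sumℚ (λ y → prob g x y * v y)
    atRand x eq = trans (fixedPoint x) (step-rand v x eq)

-- Best responses, traps and switch sets

-- If v y < v x, then v is a super-solution for the deviation of τ to y at x, so the deviation's
-- value lies below v and would beat τ at x.
bestResponse-minArc : ∀ {n} (g : Game n) → IsSSG g → (σ : MaxStrategy g) {v : Vector ℚ n} →
  IsMaxValue g σ v → ∀ {x y} → kind g x ≡ MINv → Arc g x y → v x ≤ v y
bestResponse-minArc g ssg σ {v} (τ , v-value , τ-best) {x} {y} eq x→y with v x ≤? v y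
... | yes vx≤vy = vx≤vy
... | no  vx≰vy = ⊥-elim (<-irrefl refl (<-≤-trans (≰⇒> vx≰vy) vx≤vy))
  where
  deviation : MinStrategy g
  deviation = updateAt (proj₁ τ) x (λ _ → y) , deviation-arcs
    where
    deviation-arcs : ∀ z → kind g z ≡ MINv → Arc g z (updateAt (proj₁ τ) x (λ _ → y) z)
    deviation-arcs z ez with z Fin.≟ x
    ... | yes refl = subst (Arc g z) (sym (updateAt-updates z (proj₁ τ))) x→y
    ... | no  z≢x  = subst (Arc g z) (sym (updateAt-minimal z x (proj₁ τ) z≢x)) (proj₂ τ z ez)
  open Play g ssg σ deviation using (step; step-min; value; module Value)
  w = proj₁ value
  v-super : step v ≤ᵥ v
  v-super z with z Fin.≟ x
  ... | yes refl = ≤-trans (≤-reflexive (trans (step-min v z eq) (cong v (updateAt-updates z (proj₁ τ)))))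
                           (<⇒≤ (≰⇒> vx≰vy))
  ... | no  z≢x  = ≤-reflexive (sym (trans (Play.Value.fixedPoint g ssg σ τ v-value z)
      (cong (λ t → kindStep (kind g z) (val g z) (proj₁ σ z) t (prob g z) v)
            (sym (updateAt-minimal z x (proj₁ τ) z≢x)))))
  w≤v : w ≤ᵥ v
  w≤v = Value.≤superSolution (proj₂ value) (Play.Value.0≤v g ssg σ τ v-value) v-super
  vx≤vy : v x ≤ v y
  vx≤vy = begin
    v x                                     ≤⟨ τ-best deviation w (proj₂ value) x ⟩
    w x                                     ≡⟨ Value.atMin (proj₂ value) x eq ⟩
    w (updateAt (proj₁ τ) x (λ _ → y) x)    ≡⟨ cong w (updateAt-updates x (proj₁ τ)) ⟩
    w y                                     ≤⟨ w≤v y ⟩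
    v y                                     ∎
    where open ≤-Reasoning

record IsTrap {n} (g : Game n) (σ : MaxStrategy g) (τ : MinStrategy g) (A : Fin n → Set) : Set where
  field
    noSink   : ∀ {z} → A z → ¬ kind g z ≡ SINKv
    maxStep  : ∀ {z} → A z → kind g z ≡ MAXv → A (proj₁ σ z)
    minStep  : ∀ {z} → A z → kind g z ≡ MINv → A (proj₁ τ z)
    randStep : ∀ {z} → A z → kind g z ≡ RANDv → ∀ y → ¬ prob g z y ≡ 0ℚ → A y

-- The indicator of the complement of a trap is a nonnegative super-solution.
trap⇒value≤0 : ∀ {n} (g : Game n) → IsSSG g → (σ : MaxStrategy g) (τ : MinStrategy g) {A : Fin n → Set} →
  (∀ z → Dec (A z)) → IsTrap g σ τ A → ∀ {w} → IsValue g σ τ w → ∀ {z} → A z → w z ≤ 0ℚ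
trap⇒value≤0 g ssg σ τ {A} A? trap {w} w-value {z} z∈A =
  subst (w z ≤_) (outside-A≡0 z∈A) (Value.≤superSolution w-value 0≤outside-A step-outside-A≤ z)
  where
  open Play g ssg σ τ
  open IsTrap trap
  outside-A : Vector ℚ _
  outside-A z with A? z
  ... | yes _ = 0ℚ
  ... | no  _ = 1ℚ
  outside-A≡0 : ∀ {z} → A z → outside-A z ≡ 0ℚ
  outside-A≡0 {z} z∈A with A? z
  ... | yes _   = refl
  ... | no  z∉A = ⊥-elim (z∉A z∈A)
  0≤outside-A : 0ᵥ ≤ᵥ outside-A
  0≤outside-A z with A? z
  ... | yes _ = ≤-refl
  ... | no  _ = 0≤1
  outside-A≤1 : ∀ z → outside-A z ≤ 1ℚ
  outside-A≤1 z with A? z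
  ... | yes _ = 0≤1
  ... | no  _ = ≤-refl
  step-inside≡0 : ∀ {z} → A z → step outside-A z ≡ 0ℚ
  step-inside≡0 {z} z∈A with kind g z in eq
  ... | SINKv = ⊥-elim (noSink z∈A eq)
  ... | MAXv  = trans (AtVertex.atMax z outside-A) (outside-A≡0 (maxStep z∈A eq))
  ... | MINv  = trans (AtVertex.atMin z outside-A) (outside-A≡0 (minStep z∈A eq))
  ... | RANDv = trans (AtVertex.atRand z outside-A) (sumℚ-zero term≡0)
    where
    term≡0 : ∀ y → prob g z y * outside-A y ≡ 0ℚ
    term≡0 y with prob g z y ≟ 0ℚ
    ... | yes p≡0 = trans (cong (_* outside-A y) p≡0) (*-zeroˡ (outside-A y))
    ... | no  p≢0 =
      trans (cong (prob g z y *_) (outside-A≡0 (randStep z∈A eq y p≢0))) (*-zeroʳ (prob g z y))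
  step-outside-A≤ : step outside-A ≤ᵥ outside-A
  step-outside-A≤ z with A? z
  ... | yes z∈A = ≤-reflexive (step-inside≡0 z∈A)
  ... | no  _   = ≤-trans (affine-mono outside-A≤1 z) (step-1≤1 z)

binary-otherArc : ∀ {n} (g : Game n) → IsBinary g → ∀ {x a b c} → kind g x ≡ MAXv →
  Arc g x a → Arc g x b → ¬ a ≡ b → Arc g x c → ¬ c ≡ a → c ≡ b
binary-otherArc g binary {x} eq x→a x→b a≢b x→c c≢a
  with binary x eq
... | y , y′ , _ , _ , _ , onlyArcs
  with onlyArcs _ x→a | onlyArcs _ x→b | onlyArcs _ x→c
... | inj₁ a≡y | inj₁ b≡y  | _         = ⊥-elim (a≢b (trans a≡y (sym b≡y)))
... | inj₂ a≡y′ | inj₂ b≡y′ | _        = ⊥-elim (a≢b (trans a≡y′ (sym b≡y′)))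
... | inj₁ a≡y | inj₂ b≡y′ | inj₁ c≡y  = ⊥-elim (c≢a (trans c≡y (sym a≡y)))
... | inj₁ a≡y | inj₂ b≡y′ | inj₂ c≡y′ = trans c≡y′ (sym b≡y′)
... | inj₂ a≡y′ | inj₁ b≡y | inj₁ c≡y  = trans c≡y (sym b≡y)
... | inj₂ a≡y′ | inj₁ b≡y | inj₂ c≡y′ = ⊥-elim (c≢a (trans c≡y′ (sym a≡y′)))

module SwitchInclusion {n} (g : Game n) (ssg : IsSSG g) (binary : IsBinary g)
    (σ σ′ : MaxStrategy g) {v v′ : Vector ℚ n} (v-opt : IsMaxValue g σ v) (v′-opt : IsMaxValue g σ′ v′)
    (S⊆S′ : ∀ x → InSwitch g v x → InSwitch g v′ x) where

  τ = proj₁ v-opt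
  module V  = Play.Value g ssg σ τ (proj₁ (proj₂ v-opt))
  module V′ = Play.Value g ssg σ′ (proj₁ v′-opt) (proj₁ (proj₂ v′-opt))

  gap : Vector ℚ n
  gap z = v′ z - v z

  gap-mono : ∀ {z t} → v′ z ≤ v′ t → v t ≤ v z → gap z ≤ gap t
  gap-mono v′z≤v′t vt≤vz = +-mono-≤ v′z≤v′t (neg-antimono-≤ vt≤vz)

  module MaximalGap (M : ℚ) (gap≤M : ∀ z → gap z ≤ M) (0<M : 0ℚ < M) where

    Maximal : Fin n → Set
    Maximal z = gap z ≡ M

    maximal-step : ∀ {z t} → Maximal z → v′ z ≤ v′ t → v t ≤ v z → Maximal t
    maximal-step {z} {t} z-max v′z≤v′t vt≤vz =
      ≤-antisym (gap≤M t) (subst (_≤ gap t) z-max (gap-mono v′z≤v′t vt≤vz))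

    switch⇒M<gap : ∀ {z} → Maximal z → kind g z ≡ MAXv → v (proj₁ σ z) < v (proj₁ σ′ z) →
      M < gap (proj₁ σ z)
    switch⇒M<gap {z} z-max eq vσz<vσ′z = improving (S⊆S′ z (eq , proj₁ σ′ z , proj₂ σ′ z eq , vz<vσ′z))
      where
      vz<vσ′z : v z < v (proj₁ σ′ z)
      vz<vσ′z = subst (_< v (proj₁ σ′ z)) (sym (V.atMax z eq)) vσz<vσ′z
      improving : InSwitch g v′ z → M < gap (proj₁ σ z)
      improving (_ , c , z→c , v′z<v′c) = subst (_< gap (proj₁ σ z)) z-max
        (+-mono-<-≤ (subst (v′ z <_) (cong v′ c≡σz) v′z<v′c)
                    (neg-antimono-≤ (≤-reflexive (sym (V.atMax z eq)))))
        where
        c≡σz : c ≡ proj₁ σ z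
        c≡σz = binary-otherArc g binary eq (proj₂ σ′ z eq) (proj₂ σ z eq)
          (λ σ′z≡σz → <-irrefl (cong v (sym σ′z≡σz)) vσz<vσ′z) z→c
          (λ c≡σ′z → <-irrefl (trans (V′.atMax z eq) (cong v′ (sym c≡σ′z))) v′z<v′c)

    maxStep : ∀ {z} → Maximal z → kind g z ≡ MAXv → Maximal (proj₁ σ′ z)
    maxStep {z} z-max eq with v (proj₁ σ′ z) ≤? v (proj₁ σ z)
    ... | yes vσ′z≤vσz = maximal-step z-max (≤-reflexive (V′.atMax z eq))
                           (≤-trans vσ′z≤vσz (≤-reflexive (sym (V.atMax z eq))))
    ... | no  vσ′z≰vσz = ⊥-elim (<-irrefl refl
                           (<-≤-trans (switch⇒M<gap z-max eq (≰⇒> vσ′z≰vσz)) (gap≤M (proj₁ σ z))))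

    trap : IsTrap g σ′ τ Maximal
    trap = record
      { noSink   = λ {z} z-max eq → <-irrefl (trans (sym (gap≡0 z eq)) z-max) 0<M
      ; maxStep  = maxStep
      ; minStep  = λ {z} z-max eq → maximal-step z-max
          (bestResponse-minArc g ssg σ′ v′-opt eq (proj₂ τ z eq)) (≤-reflexive (sym (V.atMin z eq)))
      ; randStep = λ {z} z-max eq → weightedMean≡max⇒support≡max (prob g z) gap
          (λ y → IsSSG.probNonneg ssg z y eq) (IsSSG.probSum ssg z eq) gap≤M (trans (mean-gap z eq) z-max)
      }
      where
      gap≡0 : ∀ z → kind g z ≡ SINKv → gap z ≡ 0ℚ
      gap≡0 z eq = trans (cong₂ _-_ (V′.atSink z eq) (V.atSink z eq)) (+-inverseʳ (val g z))
      mean-gap : ∀ z → kind g z ≡ RANDv → sumℚ (λ y → prob g z y * gap y) ≡ gap z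
      mean-gap z eq = begin
        sumℚ (λ y → prob g z y * gap y)
          ≡⟨ sumℚ-cong (λ y → solve 3 (λ p a b → p :* (a :- b) := p :* a :- p :* b)
                                      refl (prob g z y) (v′ y) (v y)) ⟩
        sumℚ (λ y → prob g z y * v′ y - prob g z y * v y)
          ≡⟨ sumℚ-distrib-- (λ y → prob g z y * v′ y) (λ y → prob g z y * v y) ⟩
        sumℚ (λ y → prob g z y * v′ y) - sumℚ (λ y → prob g z y * v y)
          ≡⟨ sym (cong₂ _-_ (V′.atRand z eq) (V.atRand z eq)) ⟩
        gap z ∎
        where open ≡-Reasoning

  v′≤v : v′ ≤ᵥ v
  v′≤v y = p-q≤0⇒p≤q (≤-trans (gap≤gapₘ y) gapₘ≤0)
    where
    m = proj₁ (maximizer gap y)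
    gap≤gapₘ = proj₂ (maximizer gap y)
    gapₘ≤0 : gap m ≤ 0ℚ
    gapₘ≤0 with gap m ≤? 0ℚ
    ... | yes gapₘ≤0 = gapₘ≤0
    ... | no  gapₘ≰0 = ⊥-elim (<-irrefl refl (<-≤-trans 0<v′m v′m≤0))
      where
      open MaximalGap (gap m) gap≤gapₘ (≰⇒> gapₘ≰0)
      w = Play.value g ssg σ′ τ
      v′m≤0 : v′ m ≤ 0ℚ
      v′m≤0 = ≤-trans (proj₂ (proj₂ v′-opt) τ (proj₁ w) (proj₂ w) m)
                      (trap⇒value≤0 g ssg σ′ τ (λ z → gap z ≟ gap m) trap (proj₂ w) refl)
      0<v′m : 0ℚ < v′ m
      0<v′m = ≤-<-trans (V.0≤v m) (0<q-p⇒p<q (≰⇒> gapₘ≰0))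

maxValue-atMax : ∀ {n} (g : Game n) → IsSSG g → (σ : MaxStrategy g) {v : Vector ℚ n} → IsMaxValue g σ v →
  ∀ {x} → kind g x ≡ MAXv → v x ≡ v (proj₁ σ x)
maxValue-atMax g ssg σ (τ , v-value , _) {x} = Play.Value.atMax g ssg σ τ v-value x

equalValues⇒agreeOnSwitches : ∀ {n} (g : Game n) → IsSSG g → IsBinary g →
  (σ σ′ : MaxStrategy g) {v v′ : Vector ℚ n} → IsMaxValue g σ v → IsMaxValue g σ′ v′ →
  (∀ x → v x ≡ v′ x) → ∀ x → InSwitch g v x → proj₁ σ x ≡ proj₁ σ′ x
equalValues⇒agreeOnSwitches g ssg binary σ σ′ {v} {v′} v-opt v′-opt v≡v′ x (eq , c , x→c , vx<vc)
  with proj₁ σ x Fin.≟ proj₁ σ′ x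
... | yes σx≡σ′x = σx≡σ′x
... | no  σx≢σ′x = ⊥-elim (<-irrefl vx≡vc vx<vc)
  where
  c≡σ′x : c ≡ proj₁ σ′ x
  c≡σ′x = binary-otherArc g binary eq (proj₂ σ x eq) (proj₂ σ′ x eq) σx≢σ′x x→c
    (λ c≡σx → <-irrefl (trans (maxValue-atMax g ssg σ v-opt eq) (cong v (sym c≡σx))) vx<vc)
  vx≡vc : v x ≡ v c
  vx≡vc = begin
    v x              ≡⟨ v≡v′ x ⟩
    v′ x             ≡⟨ maxValue-atMax g ssg σ′ v′-opt eq ⟩
    v′ (proj₁ σ′ x)  ≡⟨ sym (v≡v′ (proj₁ σ′ x)) ⟩
    v (proj₁ σ′ x)   ≡⟨ cong v (sym c≡σ′x) ⟩
    v c              ∎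
    where open ≡-Reasoning

mainTheorem3 : ∀ {n} (g : Game n) → IsSSG g → IsBinary g →
    (σ σ′ : MaxStrategy g) (v v′ : Fin n → ℚ) →
    IsMaxValue g σ v → IsMaxValue g σ′ v′ →
    (∀ x → InSwitch g v x → InSwitch g v′ x) →
    (∀ x → InSwitch g v′ x → InSwitch g v x) →
    (∀ x → v x ≡ v′ x) × (∀ x → InSwitch g v x → proj₁ σ x ≡ proj₁ σ′ x)
mainTheorem3 g ssg binary σ σ′ v v′ v-opt v′-opt S⊆S′ S′⊆S =
  v≡v′ , equalValues⇒agreeOnSwitches g ssg binary σ σ′ v-opt v′-opt v≡v′
  where
  v≡v′ : ∀ x → v x ≡ v′ x
  v≡v′ x = ≤-antisym (SwitchInclusion.v′≤v g ssg binary σ′ σ v′-opt v-opt S′⊆S x)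
                     (SwitchInclusion.v′≤v g ssg binary σ σ′ v-opt v′-opt S⊆S′ x)
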